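{- Let $s$ be a string and $u=s[1..|u|]$ a prefix of $s$. Let $b$ be an op-border of $u$ with $0\le b<|u|$, and let $b_1,\dots,b_f,b_{f+1}$ be the blocks defined by $b$. Suppose block $b_2$ contains a leftmost occurrence of $s$. Then each of the blocks $b_1,b_2,\dots,b_f$ contains a leftmost occurrence of $s$.
   Context: Strings are finite sequences over a totally ordered alphabet, indexed from $1$; $s[i..j]$ denotes a fragment. Two strings $x,y$ are order-isomorphic, written $x\approx y$, if $|x|=|y|$ and for all $i,j$ we have $x[i]\le x[j]$ iff $y[i]\le y[j]$. An integer $b$ with $0\le b\le|u|$ is an op-border of $u$ if $u[1..b]\approx u[|u|-b+1..|u|]$. The blocks defined by an op-border $b<|u|$ are obtained with $\Delta=|u|-b$: - $b_j=u[(j-1)\Delta+1..j\Delta]$ for $j=1,\dots,f$, where $f=\lfloor |u|/\Delta\rfloor$; - the incomplete block $b_{f+1}=u[f\Delta+1..|u|]$, possibly empty. A position $i$ of $s$ is a leftmost occurrence if $s[i']\ne s[i]$ for all $i'<i$. A block contains a leftmost occurrence if one of its positions (as positions of $s$) is a leftmost occurrence. -}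

module Defs where

open import Data.Nat using (ℕ; zero; suc; _+_; _*_; _∸_; _≤_; _<_)
open import Data.Product using (Σ; _×_; _,_; ∃-syntax)
open import Relation.Binary.PropositionalEquality using (_≡_)
open import Relation.Nullary using (¬_)
open import Function.Bundles using (_⇔_)

-- A string of length n over the totally ordered alphabet (ℕ, ≤) is
-- represented by a function s : ℕ → ℕ, of which only the values at the
-- positions 1..n are relevant (positions are indexed from 1).

OrderIso : (x : ℕ → ℕ) (i : ℕ) (y : ℕ → ℕ) (j : ℕ) (m : ℕ) → Set
OrderIso x i y j m =
  ∀ k l → 1 ≤ k → k ≤ m → 1 ≤ l → l ≤ m →
    (x (i + k) ≤ x (i + l)) ⇔ (y (j + k) ≤ y (j + l))

OpBorder : (s : ℕ → ℕ) (n b : ℕ) → Set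
OpBorder s n b = b ≤ n × OrderIso s 0 s (n ∸ b) b

LeftmostOcc : (s : ℕ → ℕ) (len i : ℕ) → Set
LeftmostOcc s len i = 1 ≤ i × i ≤ len × (∀ i' → 1 ≤ i' → i' < i → ¬ (s i' ≡ s i))

BlockHasLeftmost : (s : ℕ → ℕ) (len Δ j : ℕ) → Set
BlockHasLeftmost s len Δ j =
  ∃[ i ] ((j ∸ 1) * Δ + 1 ≤ i × i ≤ j * Δ × LeftmostOcc s len i)

{-# OPTIONS --safe #-}
module Submission where

open import Defs
open import Data.Nat using (ℕ; _≤_; _<_; _∸_; _/_; NonZero; >-nonZero)
open import Data.Nat.Properties using (m<n⇒0<n∸m)
open import Data.Nat using (zero; suc; _+_; _*_; _⊔_; z≤n; s≤s; _≟_; _≤?_; anyUpTo?)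
open import Data.Nat.Properties
open import Data.Nat.DivMod using (m/n*n≤m)
open import Data.Nat.Induction using (<-rec; <-wellFounded)
open import Data.Product using (∃-syntax; _×_; _,_)
open import Data.Sum using (_⊎_; inj₁; inj₂)
open import Function.Bundles using (Equivalence)
open import Induction.InfiniteDescent using (descent∧wf⇒empty)
import Relation.Binary.Construct.On as On
open import Relation.Binary.PropositionalEquality
  using (_≡_; refl; sym; trans; subst; cong; module ≡-Reasoning)
open import Relation.Nullary using (¬_; yes; no; contradiction)
open import Relation.Nullary.Decidable using (_×-dec_)

-- Let i be a leftmost occurrence in block j ≥ 2 and suppose block j + 1 has none, so
-- every letter of s[1..(j+1)Δ] already occurs in s[1..jΔ].  The op-border makes
-- s[Δ+1..(j+1)Δ] an order-isomorphic copy of s[1..jΔ] using only letters of s[1..jΔ];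
-- such a copy is equal to the original, hence s[i−Δ] = s[i], contradicting the
-- leftmostness of i.  Block 1 contains position 1, and induction from block 2 covers
-- the remaining blocks.

orderIso-prefix : ∀ x i y j {m m'} → m' ≤ m → OrderIso x i y j m → OrderIso x i y j m'
orderIso-prefix _ _ _ _ m'≤m x≈y k l 1≤k k≤m' 1≤l l≤m' =
  x≈y k l 1≤k (≤-trans k≤m' m'≤m) 1≤l (≤-trans l≤m' m'≤m)

upperBound : (f : ℕ → ℕ) (m : ℕ) → ∃[ M ] (∀ k → k ≤ m → f k ≤ M)
upperBound f zero = f 0 , λ { k z≤n → ≤-refl }
upperBound f (suc m) with upperBound f m
... | M , f≤M = f (suc m) ⊔ M , f≤max
  where
  f≤max : ∀ k → k ≤ suc m → f k ≤ f (suc m) ⊔ M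
  f≤max k k≤1+m with m≤n⇒m<n∨m≡n k≤1+m
  ... | inj₁ k<1+m = ≤-trans (f≤M k (≤-pred k<1+m)) (m≤n⊔m (f (suc m)) M)
  ... | inj₂ refl  = m≤m⊔n (f (suc m)) M

∀⊎-distrib : ∀ {a b} {A : ℕ → Set a} {B : Set b} m →
  (∀ l → 1 ≤ l → l ≤ m → A l ⊎ B) → (∀ l → 1 ≤ l → l ≤ m → A l) ⊎ B
∀⊎-distrib zero _ = inj₁ λ l 1≤l l≤0 → contradiction (≤-trans 1≤l l≤0) λ ()
∀⊎-distrib {A = A} (suc m) A⊎B
  with ∀⊎-distrib m (λ l 1≤l l≤m → A⊎B l 1≤l (m≤n⇒m≤1+n l≤m)) | A⊎B (suc m) (s≤s z≤n) ≤-refl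
... | inj₂ b  | _      = inj₂ b
... | inj₁ _  | inj₂ b = inj₂ b
... | inj₁ A≤m | inj₁ A[1+m] = inj₁ A≤1+m
  where
  A≤1+m : ∀ l → 1 ≤ l → l ≤ suc m → A l
  A≤1+m l 1≤l l≤1+m with m≤n⇒m<n∨m≡n l≤1+m
  ... | inj₁ l<1+m = A≤m l 1≤l (≤-pred l<1+m)
  ... | inj₂ refl  = A[1+m]

-- Where the copy y rises above x (resp. falls below x), the position of x carrying the
-- copy's letter holds a larger (resp. smaller) letter of x, and by order-isomorphism the
-- copy rises (resp. falls) there again; this cannot go on forever.
module _ (x : ℕ → ℕ) (i : ℕ) (y : ℕ → ℕ) (j : ℕ) {m : ℕ} (x≈y : OrderIso x i y j m)
  (letters⊆ : ∀ l → 1 ≤ l → l ≤ m → ∃[ k ] (1 ≤ k × k ≤ m × x (i + k) ≡ y (j + l))) where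

  private
    X Y : ℕ → ℕ
    X k = x (i + k)
    Y k = y (j + k)

    InRange : ℕ → Set
    InRange k = 1 ≤ k × k ≤ m

    Rise Fall : ℕ → Set
    Rise k = InRange k × X k < Y k
    Fall k = InRange k × Y k < X k

    reflect : ∀ {k l} → InRange k → InRange l → Y k ≤ Y l → X k ≤ X l
    reflect (1≤k , k≤m) (1≤l , l≤m) = Equivalence.from (x≈y _ _ 1≤k k≤m 1≤l l≤m)

    rise-ascends : ∀ {k} → Rise k → ∃[ k' ] (X k < X k' × Rise k')
    rise-ascends {k} (k∈@(1≤k , k≤m) , Xk<Yk) with letters⊆ k 1≤k k≤m
    ... | k' , 1≤k' , k'≤m , Xk'≡Yk = k' , Xk<Xk' , k'∈ , Xk'<Yk'
      where
      k'∈ : InRange k'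
      k'∈ = 1≤k' , k'≤m
      Xk<Xk' : X k < X k'
      Xk<Xk' = subst (X k <_) (sym Xk'≡Yk) Xk<Yk
      Xk'<Yk' : X k' < Y k'
      Xk'<Yk' = ≰⇒> λ Yk'≤Xk' →
        <⇒≱ Xk<Xk' (reflect k'∈ k∈ (subst (Y k' ≤_) Xk'≡Yk Yk'≤Xk'))

    fall-descends : ∀ {k} → Fall k → ∃[ k' ] (X k' < X k × Fall k')
    fall-descends {k} (k∈@(1≤k , k≤m) , Yk<Xk) with letters⊆ k 1≤k k≤m
    ... | k' , 1≤k' , k'≤m , Xk'≡Yk = k' , Xk'<Xk , k'∈ , Yk'<Xk'
      where
      k'∈ : InRange k'
      k'∈ = 1≤k' , k'≤m
      Xk'<Xk : X k' < X k
      Xk'<Xk = subst (_< X k) (sym Xk'≡Yk) Yk<Xk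
      Yk'<Xk' : Y k' < X k'
      Yk'<Xk' = ≰⇒> λ Xk'≤Yk' →
        <⇒≱ Xk'<Xk (reflect k∈ k'∈ (subst (_≤ Y k') Xk'≡Yk Xk'≤Yk'))

    no-rise : ∀ k → ¬ Rise k
    no-rise with upperBound X m
    ... | M , X≤M = descent∧wf⇒empty rise-descent (On.wellFounded (λ k → M ∸ X k) <-wellFounded)
      where
      rise-descent : ∀ {k} → Rise k → ∃[ k' ] (M ∸ X k' < M ∸ X k × Rise k')
      rise-descent r with rise-ascends r
      ... | k' , Xk<Xk' , r'@((_ , k'≤m) , _) = k' , ∸-monoʳ-< Xk<Xk' (X≤M k' k'≤m) , r'

    no-fall : ∀ k → ¬ Fall k
    no-fall = descent∧wf⇒empty fall-descends (On.wellFounded X <-wellFounded)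

  orderIso∧letters⊆⇒≡ : ∀ k → 1 ≤ k → k ≤ m → y (j + k) ≡ x (i + k)
  orderIso∧letters⊆⇒≡ k 1≤k k≤m = ≤-antisym
    (≮⇒≥ λ Xk<Yk → no-rise k ((1≤k , k≤m) , Xk<Yk))
    (≮⇒≥ λ Yk<Xk → no-fall k ((1≤k , k≤m) , Yk<Xk))

leftmostOccurrenceOf : (s : ℕ → ℕ) (len p : ℕ) → 1 ≤ p → p ≤ len →
  ∃[ q ] (q ≤ p × s q ≡ s p × LeftmostOcc s len q)
leftmostOccurrenceOf s len = <-rec Occurs occurs
  where
  Occurs : ℕ → Set
  Occurs p = 1 ≤ p → p ≤ len → ∃[ q ] (q ≤ p × s q ≡ s p × LeftmostOcc s len q)
  occurs : ∀ p → (∀ {p'} → p' < p → Occurs p') → Occurs p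
  occurs p rec 1≤p p≤len with anyUpTo? (λ i' → 1 ≤? i' ×-dec s i' ≟ s p) p
  ... | yes (i' , i'<p , 1≤i' , si'≡sp) with rec i'<p 1≤i' (≤-trans (<⇒≤ i'<p) p≤len)
  ...   | q , q≤i' , sq≡si' , q-leftmost =
          q , ≤-trans q≤i' (<⇒≤ i'<p) , trans sq≡si' si'≡sp , q-leftmost
  occurs p rec 1≤p p≤len | no no-earlier =
    p , ≤-refl , refl , 1≤p , p≤len ,
    λ i' 1≤i' i'<p si'≡sp → no-earlier (i' , i'<p , 1≤i' , si'≡sp)

block₁-hasLeftmost : ∀ s len D → 1 ≤ D → 1 ≤ len → BlockHasLeftmost s len D 1
block₁-hasLeftmost s len D 1≤D 1≤len =
  1 , ≤-refl , ≤-trans 1≤D (m≤m+n D 0) , ≤-refl , 1≤len ,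
  λ i' 1≤i' i'<1 → contradiction (<-≤-trans i'<1 1≤i') (<-irrefl refl)

letter-recurs-or-newInBlock : ∀ s len D j → suc j * D ≤ len → ∀ l → 1 ≤ l → l ≤ j * D →
  ∃[ k ] (1 ≤ k × k ≤ j * D × s k ≡ s (D + l)) ⊎ BlockHasLeftmost s len D (suc j)
letter-recurs-or-newInBlock s len D j [1+j]D≤len l 1≤l l≤jD
  with leftmostOccurrenceOf s len (D + l) (≤-trans 1≤l (m≤n+m l D))
                                          (≤-trans (+-monoʳ-≤ D l≤jD) [1+j]D≤len)
... | q , q≤D+l , sq≡sD+l , q-leftmost@(1≤q , _) with q ≤? j * D
...   | yes q≤jD = inj₁ (q , 1≤q , q≤jD , sq≡sD+l)
...   | no  q≰jD = inj₂ (q , subst (_≤ q) (+-comm 1 (j * D)) (≰⇒> q≰jD) ,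
                         ≤-trans q≤D+l (+-monoʳ-≤ D l≤jD) , q-leftmost)

leftmost-in-next-block : ∀ s len D j → 1 ≤ D → 2 ≤ j → OrderIso s 0 s D (j * D) →
  suc j * D ≤ len → BlockHasLeftmost s len D j → BlockHasLeftmost s len D (suc j)
leftmost-in-next-block s len D j@(suc (suc k)) 1≤D (s≤s (s≤s z≤n)) iso [1+j]D≤len
                       (i , [1+k]D+1≤i , i≤jD , _ , _ , i-leftmost)
  with ∀⊎-distrib (j * D) (letter-recurs-or-newInBlock s len D j [1+j]D≤len)
... | inj₂ next-block = next-block
... | inj₁ letters⊆ =
  contradiction s[i∸D]≡s[i] (i-leftmost (i ∸ D) (m<n⇒0<n∸m D<i) (∸-monoʳ-< 1≤D (<⇒≤ D<i)))
  where
  D<i : D < i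
  D<i = ≤-trans (s≤s (m≤m+n D (k * D))) (subst (_≤ i) (+-comm (suc k * D) 1) [1+k]D+1≤i)
  s[i∸D]≡s[i] : s (i ∸ D) ≡ s i
  s[i∸D]≡s[i] = begin
    s (i ∸ D)       ≡⟨ sym (orderIso∧letters⊆⇒≡ s 0 s D iso letters⊆
                             (i ∸ D) (m<n⇒0<n∸m D<i) (≤-trans (m∸n≤m i D) i≤jD)) ⟩
    s (D + (i ∸ D)) ≡⟨ cong s (m+[n∸m]≡n (<⇒≤ D<i)) ⟩
    s i             ∎
    where open ≡-Reasoning

lemma11 : (s : ℕ → ℕ) (len n b : ℕ) → n ≤ len → (b<n : b < n) → OpBorder s n b →
    let instance _ = >-nonZero (m<n⇒0<n∸m b<n) in
    2 ≤ n / (n ∸ b) → BlockHasLeftmost s len (n ∸ b) 2 →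
    ∀ j → 1 ≤ j → j ≤ n / (n ∸ b) → BlockHasLeftmost s len (n ∸ b) j
lemma11 s len n b n≤len b<n (b≤n , border) _ block₂ j 1≤j j≤f =
  blocks j 1≤j (≤-trans (*-monoˡ-≤ Δ j≤f) (m/n*n≤m n Δ))
  where
  instance _ = >-nonZero (m<n⇒0<n∸m b<n)
  Δ : ℕ
  Δ = n ∸ b
  1≤Δ : 1 ≤ Δ
  1≤Δ = m<n⇒0<n∸m b<n
  blocks : ∀ j → 1 ≤ j → j * Δ ≤ n → BlockHasLeftmost s len Δ j
  blocks 1 _ _ = block₁-hasLeftmost s len Δ 1≤Δ (≤-trans (≤-trans 1≤Δ (m∸n≤m n b)) n≤len)
  blocks 2 _ _ = block₂
  blocks (suc j@(suc (suc _))) _ [1+j]Δ≤n =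
    leftmost-in-next-block s len Δ j 1≤Δ (s≤s (s≤s z≤n)) (orderIso-prefix s 0 s Δ jΔ≤b border)
      (≤-trans [1+j]Δ≤n n≤len) (blocks j (s≤s z≤n) (m+n≤o⇒n≤o Δ [1+j]Δ≤n))
    where
    jΔ≤b : j * Δ ≤ b
    jΔ≤b = +-cancelˡ-≤ Δ _ _ (subst (suc j * Δ ≤_) (sym (m∸n+n≡m b≤n)) [1+j]Δ≤n)
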